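{- For every $d\in\mathbb{N}$, $n\in\mathbb{N}_{\ge1}$ and $x\in\mathbb{R}\setminus\{0\}$, $$\sum_{k=1}^{n-1}q_{s_k}(k)^d\,x^{q_{s_k}(k)}=T(d,q_{s_n}(n),2x)+n\,q_{s_n}(n)^d\,x^{q_{s_n}(n)}-q_{s_n}(n)^d\,(2x)^{q_{s_n}(n)}.$$
   Context: For $k\in\mathbb{N}_{\ge1}$ write its binary decomposition $k=\sum_{j=1}^{s_k}2^{q_j(k)}$ with $0\le q_1(k)<\cdots<q_{s_k}(k)$, so $q_{s_k}(k)=\lfloor\log_2 k\rfloor$. For $d,N\in\mathbb{N}$ and $x\neq0$, $T(d,N,x)=\sum_{j=0}^{N-1}j^dx^j$. Convention $0^0=1$. -}

module Defs where

open import Level using (Level)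
open import Data.Bool using (true; false)
open import Data.Nat as ℕ using (ℕ; zero; suc)
open import Data.Nat.Logarithm using (⌊log₂_⌋)
open import Algebra.Bundles using (CommutativeRing; Semiring)
import Algebra.Definitions.RawSemiring as RS

-- q_{s_k}(k): the largest exponent in the binary decomposition of k (k ≥ 1),
-- which equals ⌊log₂ k⌋.
topExp : ℕ → ℕ
topExp k = ⌊log₂ k ⌋

module RingDefs {c ℓ : Level} (R : CommutativeRing c ℓ) where
  open CommutativeRing R
  open RS (Semiring.rawSemiring semiring) public using (_×_; _^_)

  sumBelow : ℕ → (ℕ → Carrier) → Carrier
  sumBelow zero    f = 0#
  sumBelow (suc N) f = sumBelow N f + f N

  sumFromTo : ℕ → ℕ → (ℕ → Carrier) → Carrier
  sumFromTo a zero    f = 0#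
  sumFromTo a (suc b) f with a ℕ.≤ᵇ b
  ... | true  = sumFromTo a b f + f b
  ... | false = sumFromTo a b f

  -- T(d,N,y) = Σ_{j=0}^{N-1} j^d y^j   (j^d computed in ℕ, so 0^0 = 1)
  T : ℕ → ℕ → Carrier → Carrier
  T d N y = sumBelow N (λ j → (j ℕ.^ d) × (y ^ j))

{-# OPTIONS --safe #-}
module Submission where

-- Group the k < n by m = ⌊log₂ k⌋: a full block 2^m ≤ k < 2^(m+1) contributes
-- 2^m · m^d x^m = m^d (2x)^m, the m-th summand of T(d, m+1, 2x). Adding the terms
-- one k at a time, the right-hand side with n := k+1 but ⌊log₂⌋ kept at m = ⌊log₂ k⌋
-- grows by exactly the new term, and when k+1 = 2^(m+1) its values for m and m+1
-- coincide, both being T(d, m+1, 2x).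

open import Defs
open import Level using (Level)
open import Data.Nat as ℕ using (ℕ; suc)
open import Relation.Nullary using (¬_)
open import Algebra.Bundles using (CommutativeRing)

module ⌊log₂⌋-Properties where
  open import Data.Nat.Base
  open import Data.Nat.Properties
  open import Data.Nat.Logarithm
  open import Data.Product using (∃-syntax; _×_; _,_)
  open import Data.Sum using (_⊎_; inj₁; inj₂)
  open import Relation.Binary.PropositionalEquality
  open import Relation.Nullary using (yes; no)

  ⌊n/2⌋-lower : ∀ a n → a + a ≤ n → a ≤ ⌊ n /2⌋
  ⌊n/2⌋-lower a n a+a≤n = subst (_≤ ⌊ n /2⌋) (sym (n≡⌊n+n/2⌋ a)) (⌊n/2⌋-mono a+a≤n)

  ⌊n/2⌋-upper : ∀ a n → n < a + a → ⌊ n /2⌋ < a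
  ⌊n/2⌋-upper a n n<a+a = ≰⇒> λ a≤⌊n/2⌋ → <⇒≱ n<a+a (begin
    a + a                 ≤⟨ +-mono-≤ a≤⌊n/2⌋ (≤-trans a≤⌊n/2⌋ (⌊n/2⌋≤⌈n/2⌉ n)) ⟩
    ⌊ n /2⌋ + ⌈ n /2⌉     ≡⟨ ⌊n/2⌋+⌈n/2⌉≡n n ⟩
    n                     ∎)
    where open ≤-Reasoning

  2^[1+m]≡2^m+2^m : ∀ m → 2 ^ suc m ≡ 2 ^ m + 2 ^ m
  2^[1+m]≡2^m+2^m m = cong (2 ^ m +_) (+-identityʳ (2 ^ m))

  ⌊log₂⌋-unique : ∀ m n → 2 ^ m ≤ n → n < 2 ^ suc m → ⌊log₂ n ⌋ ≡ m
  ⌊log₂⌋-unique zero    (suc zero)    _ _ = refl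
  ⌊log₂⌋-unique zero    (suc (suc n)) _ (s≤s (s≤s ()))
  ⌊log₂⌋-unique (suc m) n 2^[1+m]≤n n<2^[2+m] = begin
    ⌊log₂ n ⌋                 ≡⟨ m+[n∸m]≡n 1≤⌊log₂n⌋ ⟨
    suc (⌊log₂ n ⌋ ∸ 1)       ≡⟨ cong suc (⌊log₂⌊n/2⌋⌋≡⌊log₂n⌋∸1 n) ⟨
    suc ⌊log₂ ⌊ n /2⌋ ⌋       ≡⟨ cong suc (⌊log₂⌋-unique m ⌊ n /2⌋ lower upper) ⟩
    suc m                     ∎
    where
    open ≡-Reasoning
    lower : 2 ^ m ≤ ⌊ n /2⌋
    lower = ⌊n/2⌋-lower (2 ^ m) n (subst (_≤ n) (2^[1+m]≡2^m+2^m m) 2^[1+m]≤n)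
    upper : ⌊ n /2⌋ < 2 ^ suc m
    upper = ⌊n/2⌋-upper (2 ^ suc m) n (subst (n <_) (2^[1+m]≡2^m+2^m (suc m)) n<2^[2+m])
    1≤⌊log₂n⌋ : 1 ≤ ⌊log₂ n ⌋
    1≤⌊log₂n⌋ = ⌊log₂⌋-mono-≤ {2} (≤-trans (^-monoʳ-≤ 2 {1} {suc m} (s≤s z≤n)) 2^[1+m]≤n)

  between-powers : ∀ n → 1 ≤ n → ∃[ m ] 2 ^ m ≤ n × n < 2 ^ suc m
  between-powers (suc zero)    _ = 0 , s≤s z≤n , s≤s (s≤s z≤n)
  between-powers (suc (suc n)) _ with between-powers (suc n) (s≤s z≤n)
  ... | m , 2^m≤n , n<2^[1+m] with suc (suc n) <? 2 ^ suc m
  ...   | yes 2+n<2^[1+m] = m , m≤n⇒m≤1+n 2^m≤n , 2+n<2^[1+m]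
  ...   | no  2+n≮2^[1+m] = suc m , ≤-reflexive (sym 2+n≡2^[1+m]) , 2+n<2^[2+m]
    where
    2+n≡2^[1+m] : suc (suc n) ≡ 2 ^ suc m
    2+n≡2^[1+m] = ≤-antisym n<2^[1+m] (≮⇒≥ 2+n≮2^[1+m])
    2+n<2^[2+m] : suc (suc n) < 2 ^ suc (suc m)
    2+n<2^[2+m] = subst₂ _<_ (sym 2+n≡2^[1+m]) (sym (2^[1+m]≡2^m+2^m (suc m)))
                         (m<m+n (2 ^ suc m) (m^n>0 2 (suc m)))

  ⌊log₂⌋-suc : ∀ k → 1 ≤ k → ⌊log₂ suc k ⌋ ≡ ⌊log₂ k ⌋ ⊎ suc k ≡ 2 ^ suc ⌊log₂ k ⌋
  ⌊log₂⌋-suc k 1≤k with between-powers k 1≤k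
  ... | m , 2^m≤k , k<2^[1+m] rewrite ⌊log₂⌋-unique m k 2^m≤k k<2^[1+m]
    with suc k <? 2 ^ suc m
  ...   | yes 1+k<2^[1+m] = inj₁ (⌊log₂⌋-unique m (suc k) (m≤n⇒m≤1+n 2^m≤k) 1+k<2^[1+m])
  ...   | no  1+k≮2^[1+m] = inj₂ (≤-antisym k<2^[1+m] (≮⇒≥ 1+k≮2^[1+m]))

module ×-Properties {c ℓ : Level} (R : CommutativeRing c ℓ) where
  open CommutativeRing R
  open RingDefs R
  open import Algebra.Properties.Semiring.Mult semiring hiding (_×_)
  import Data.Nat.Properties as ℕ
  open import Relation.Binary.PropositionalEquality using (cong)
  open import Relation.Binary.Reasoning.Setoid setoid

  ×-comm : ∀ m n a → m × (n × a) ≈ n × (m × a)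
  ×-comm m n a = begin
    m × (n × a)        ≈⟨ ×-assocˡ a m n ⟩
    (m ℕ.* n) × a      ≡⟨ cong (_× a) (ℕ.*-comm m n) ⟩
    (n ℕ.* m) × a      ≈⟨ ×-assocˡ a n m ⟨
    n × (m × a)        ∎

  ^-distrib-× : ∀ n j a → (n ℕ.^ j) × (a ^ j) ≈ (n × a) ^ j
  ^-distrib-× n ℕ.zero    a = ×-homo-1 1#
  ^-distrib-× n (suc j) a = begin
    (n ℕ.* n ℕ.^ j) × (a * a ^ j)    ≈⟨ ×-assocˡ (a * a ^ j) n (n ℕ.^ j) ⟨
    n × ((n ℕ.^ j) × (a * a ^ j))    ≈⟨ ×-congʳ n (×-comm-* (n ℕ.^ j) a (a ^ j)) ⟨
    n × (a * (n ℕ.^ j) × a ^ j)      ≈⟨ ×-congʳ n (*-congˡ (^-distrib-× n j a)) ⟩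
    n × (a * (n × a) ^ j)            ≈⟨ ×-assoc-* n a ((n × a) ^ j) ⟨
    (n × a) * (n × a) ^ j            ∎

  [1+1]*≈2× : ∀ a → (1# + 1#) * a ≈ 2 × a
  [1+1]*≈2× a = begin
    (1# + 1#) * a       ≈⟨ distribʳ a 1# 1# ⟩
    1# * a + 1# * a     ≈⟨ +-cong (*-identityˡ a) (sym (×-homo-1# a)) ⟩
    a + 1 × a           ∎

module ClosedForm {c ℓ : Level} (R : CommutativeRing c ℓ) (d : ℕ) (x : CommutativeRing.Carrier R) where
  open CommutativeRing R
  open RingDefs R
  open ×-Properties R
  open ⌊log₂⌋-Properties using (⌊log₂⌋-suc)
  open import Algebra.Properties.Semiring.Mult semiring using (×-assocˡ; ×-congʳ)
  open import Algebra.Properties.AbelianGroup +-abelianGroup using (//-rightDividesʳ)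
  open import Algebra.Properties.CommutativeSemigroup +-commutativeSemigroup
    using (xy∙z≈xz∙y; xy∙z≈x∙zy)
  open import Data.Nat.Logarithm using (⌊log₂[2^n]⌋≡n)
  open import Data.Sum using (inj₁; inj₂)
  open import Relation.Binary.PropositionalEquality as ≡ using (_≡_)
  open import Relation.Binary.Reasoning.Setoid setoid

  y : Carrier
  y = (1# + 1#) * x

  term : ℕ → Carrier
  term m = (m ℕ.^ d) × (x ^ m)

  summand : ℕ → Carrier
  summand j = (j ℕ.^ d) × (y ^ j)

  closedForm : ℕ → ℕ → Carrier
  closedForm n m = T d m y + n × term m - summand m

  2^m×term≈summand : ∀ m → (2 ℕ.^ m) × term m ≈ summand m
  2^m×term≈summand m = begin
    (2 ℕ.^ m) × (m ℕ.^ d) × (x ^ m)   ≈⟨ ×-comm (2 ℕ.^ m) (m ℕ.^ d) (x ^ m) ⟩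
    (m ℕ.^ d) × (2 ℕ.^ m) × (x ^ m)   ≈⟨ ×-congʳ (m ℕ.^ d) (^-distrib-× 2 m x) ⟩
    (m ℕ.^ d) × (2 × x) ^ m           ≈⟨ ×-congʳ (m ℕ.^ d) (^-congˡ m ([1+1]*≈2× x)) ⟨
    summand m                          ∎
    where open import Algebra.Properties.Semiring.Exp semiring using (^-congˡ)

  closedForm-suc : ∀ n m → closedForm n m + term m ≈ closedForm (suc n) m
  closedForm-suc n m = begin
    T d m y + n × term m - summand m + term m    ≈⟨ xy∙z≈xz∙y (T d m y + n × term m) (- summand m) (term m) ⟩
    T d m y + n × term m + term m - summand m    ≈⟨ +-congʳ (xy∙z≈x∙zy (T d m y) (n × term m) (term m)) ⟩
    closedForm (suc n) m                         ∎

  closedForm-2^ : ∀ m → closedForm (2 ℕ.^ m) m ≈ T d m y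
  closedForm-2^ m = begin
    T d m y + (2 ℕ.^ m) × term m - summand m   ≈⟨ +-congʳ (+-congˡ (2^m×term≈summand m)) ⟩
    T d m y + summand m - summand m            ≈⟨ //-rightDividesʳ (summand m) (T d m y) ⟩
    T d m y                                    ∎

  closedForm-carry : ∀ m → closedForm (2 ℕ.^ suc m) m ≈ closedForm (2 ℕ.^ suc m) (suc m)
  closedForm-carry m = begin
    T d m y + (2 ℕ.^ suc m) × term m - s     ≈⟨ +-congʳ (+-congˡ 2^[1+m]×term≈s+s) ⟩
    T d m y + (s + s) - s                    ≈⟨ +-congʳ (+-assoc (T d m y) s s) ⟨
    T d m y + s + s - s                      ≈⟨ //-rightDividesʳ s (T d m y + s) ⟩
    T d (suc m) y                            ≈⟨ closedForm-2^ (suc m) ⟨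
    closedForm (2 ℕ.^ suc m) (suc m)         ∎
    where
    s = summand m
    2^[1+m]×term≈s+s : (2 ℕ.^ suc m) × term m ≈ s + s
    2^[1+m]×term≈s+s = begin
      (2 ℕ.* 2 ℕ.^ m) × term m     ≈⟨ ×-assocˡ (term m) 2 (2 ℕ.^ m) ⟨
      2 × (2 ℕ.^ m) × term m       ≈⟨ ×-congʳ 2 (2^m×term≈summand m) ⟩
      s + (s + 0#)                 ≈⟨ +-congˡ (+-identityʳ s) ⟩
      s + s                        ∎

  closedForm-topExp-suc : ∀ k → 1 ℕ.≤ k →
                          closedForm (suc k) (topExp k) ≈ closedForm (suc k) (topExp (suc k))
  closedForm-topExp-suc k 1≤k with ⌊log₂⌋-suc k 1≤k
  ... | inj₁ same = reflexive (≡.cong (closedForm (suc k)) (≡.sym same))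
  ... | inj₂ power = begin
    closedForm (suc k) m                    ≡⟨ ≡.cong (λ n → closedForm n m) power ⟩
    closedForm (2 ℕ.^ suc m) m              ≈⟨ closedForm-carry m ⟩
    closedForm (2 ℕ.^ suc m) (suc m)        ≡⟨ ≡.cong₂ closedForm (≡.sym power) (≡.sym topExp[1+k]≡1+m) ⟩
    closedForm (suc k) (topExp (suc k))     ∎
    where
    m = topExp k
    topExp[1+k]≡1+m : topExp (suc k) ≡ suc m
    topExp[1+k]≡1+m = ≡.trans (≡.cong topExp power) (⌊log₂[2^n]⌋≡n (suc m))

  sum≈closedForm : ∀ n → sumFromTo 1 (suc n) (λ k → term (topExp k))
                           ≈ closedForm (suc n) (topExp (suc n))
  sum≈closedForm ℕ.zero    = sym (closedForm-2^ 0)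
  sum≈closedForm (suc n) = begin
    sumFromTo 1 (suc n) (λ k → term (topExp k)) + term (topExp (suc n))
      ≈⟨ +-congʳ (sum≈closedForm n) ⟩
    closedForm (suc n) (topExp (suc n)) + term (topExp (suc n))
      ≈⟨ closedForm-suc (suc n) (topExp (suc n)) ⟩
    closedForm (suc (suc n)) (topExp (suc n))
      ≈⟨ closedForm-topExp-suc (suc n) (ℕ.s≤s ℕ.z≤n) ⟩
    closedForm (suc (suc n)) (topExp (suc (suc n)))   ∎

lemma1 : {c ℓ : Level} (R : CommutativeRing c ℓ) →
         let open CommutativeRing R
             open RingDefs R
         in (d n : ℕ) → 1 ℕ.≤ n → (x : Carrier) → ¬ (x ≈ 0#) →
            sumFromTo 1 n (λ k → (topExp k ℕ.^ d) × (x ^ topExp k))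
              ≈ T d (topExp n) ((1# + 1#) * x)
                + (n × ((topExp n ℕ.^ d) × (x ^ topExp n)))
                - ((topExp n ℕ.^ d) × (((1# + 1#) * x) ^ topExp n))
-- The identity holds in every commutative ring.
lemma1 R d (suc n) _ x _ = ClosedForm.sum≈closedForm R d x n
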